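{- Let $k\ge1$ and let $P_k$ be the path with $k$ edges. Then for all $n\ge k+1$, the uniform matroid ${\mathcal U}_{k-1}(E(K_n))$ of rank $k-1$ on $E(K_n)$ is the unique maximal $P_k$-matroid on $K_n$ (in the weak order), and ${\rm val}_{P_k}$ is its rank function.
   Context: An $H$-matroid on a graph $G$ is a matroid on $E(G)$ in which the edge set of every subgraph of $G$ isomorphic to $H$ is a circuit. Weak order: ${\mathcal M}_1\preceq{\mathcal M}_2$ if every independent set of ${\mathcal M}_1$ is independent in ${\mathcal M}_2$. Let ${\mathcal X}$ be the family of edge sets of subgraphs of $K_n$ isomorphic to $H$. A proper ${\mathcal X}$-sequence is a sequence $(X_1,\dots,X_m)$ of sets in ${\mathcal X}$ with $X_i\not\subseteq\bigcup_{j<i}X_j$ for $i\ge2$; for $F\subseteq E(K_n)$, ${\rm val}(F,{\mathcal S})=|F\cup\bigcup_iX_i|-m$, and ${\rm val}_H(F)=\min_{\mathcal S}{\rm val}(F,{\mathcal S})$ over all proper ${\mathcal X}$-sequences. -}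

module Defs where

open import Data.Bool using (Bool; true; false; if_then_else_; _∧_; _∨_; not)
open import Data.Nat using (ℕ; zero; suc; _<_; _≤_; _∸_; _<ᵇ_; _≡ᵇ_)
open import Data.Nat.Properties using (_<?_)
open import Data.Fin using (Fin; toℕ; inject₁) renaming (suc to fsuc)
open import Data.List using (List; []; _∷_; concatMap; allFin)
open import Data.Bool.ListAction using (any)
open import Data.Product using (Σ; _×_; _,_; proj₁; proj₂)
open import Data.Sum using (_⊎_)
open import Relation.Nullary using (¬_; yes; no)
open import Relation.Binary.PropositionalEquality using (_≡_)
open import Function.Definitions using (Injective)
open import Function.Bundles using (_⇔_)

-- Edges of the complete graph K_n on vertex set Fin n: pairs (i , j) with i < j.
Edge : ℕ → Set
Edge n = Σ (Fin n × Fin n) (λ p → toℕ (proj₁ p) < toℕ (proj₂ p))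

private
  pairIf : ∀ {n} → Fin n → Fin n → List (Edge n)
  pairIf i j with toℕ i <? toℕ j
  ... | yes p = ((i , j) , p) ∷ []
  ... | no _  = []

allEdges : (n : ℕ) → List (Edge n)
allEdges n = concatMap (λ i → concatMap (λ j → pairIf i j) (allFin n)) (allFin n)

EdgeSet : ℕ → Set
EdgeSet n = Edge n → Bool

count : ∀ {n} → EdgeSet n → List (Edge n) → ℕ
count F [] = 0
count F (e ∷ es) = if F e then suc (count F es) else count F es

∣_∣ₑ : ∀ {n} → EdgeSet n → ℕ
∣_∣ₑ {n} F = count F (allEdges n)

_⊆ₑ_ : ∀ {n} → EdgeSet n → EdgeSet n → Set
F ⊆ₑ G = ∀ e → F e ≡ true → G e ≡ true

∅ₑ : ∀ {n} → EdgeSet n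
∅ₑ _ = false

_∪ₑ_ : ∀ {n} → EdgeSet n → EdgeSet n → EdgeSet n
(F ∪ₑ G) e = F e ∨ G e

_==ₑ_ : ∀ {n} → Edge n → Edge n → Bool
((i , j) , _) ==ₑ ((i' , j') , _) = (toℕ i ≡ᵇ toℕ i') ∧ (toℕ j ≡ᵇ toℕ j')

insertₑ : ∀ {n} → Edge n → EdgeSet n → EdgeSet n
insertₑ e F e' = if e ==ₑ e' then true else F e'

removeₑ : ∀ {n} → Edge n → EdgeSet n → EdgeSet n
removeₑ e F e' = if e ==ₑ e' then false else F e'

record IsMatroid (n : ℕ) (Ind : EdgeSet n → Set) : Set where
  field
    ind-∅   : Ind ∅ₑ
    ind-⊆   : ∀ {I J} → J ⊆ₑ I → Ind I → Ind J
    ind-aug : ∀ {I J} → Ind I → Ind J → ∣ I ∣ₑ < ∣ J ∣ₑ →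
              Σ (Edge n) λ e → J e ≡ true × I e ≡ false × Ind (insertₑ e I)

IsCircuit : (n : ℕ) → (EdgeSet n → Set) → EdgeSet n → Set
IsCircuit n Ind C = ¬ Ind C × (∀ e → C e ≡ true → Ind (removeₑ e C))

Joins : ∀ {n} → Edge n → Fin n → Fin n → Set
Joins ((i , j) , _) a b = (i ≡ a × j ≡ b) ⊎ (i ≡ b × j ≡ a)

IsPathEdgeSet : (n k : ℕ) → EdgeSet n → Set
IsPathEdgeSet n k X =
  Σ (Fin (suc k) → Fin n) λ v →
    Injective _≡_ _≡_ v ×
    (∀ e → (X e ≡ true) ⇔ Σ (Fin k) (λ i → Joins e (v (inject₁ i)) (v (fsuc i))))

IsPkMatroid : (n k : ℕ) → (EdgeSet n → Set) → Set
IsPkMatroid n k Ind = IsMatroid n Ind × (∀ X → IsPathEdgeSet n k X → IsCircuit n Ind X)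

_≼_ : ∀ {n} → (EdgeSet n → Set) → (EdgeSet n → Set) → Set
I₁ ≼ I₂ = ∀ F → I₁ F → I₂ F

UniformInd : (n r : ℕ) → EdgeSet n → Set
UniformInd n r F = ∣ F ∣ₑ ≤ r

IsRank : (n : ℕ) → (EdgeSet n → Set) → EdgeSet n → ℕ → Set
IsRank n Ind F r =
  Σ (EdgeSet n) (λ I → I ⊆ₑ F × Ind I × ∣ I ∣ₑ ≡ r) ×
  (∀ I → I ⊆ₑ F → Ind I → ∣ I ∣ₑ ≤ r)

-- Sequences (X_0,…,X_{m-1}) indexed by Fin m (0-based).
unionBefore : ∀ {n m} → (Fin m → EdgeSet n) → Fin m → EdgeSet n
unionBefore {n} {m} S i e = any (λ j → (toℕ j <ᵇ toℕ i) ∧ S j e) (allFin m)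

unionAll : ∀ {n m} → (Fin m → EdgeSet n) → EdgeSet n
unionAll {n} {m} S e = any (λ j → S j e) (allFin m)

IsProperSeq : (n k m : ℕ) → (Fin m → EdgeSet n) → Set
IsProperSeq n k m S =
  (∀ i → IsPathEdgeSet n k (S i)) ×
  (∀ i → 1 ≤ toℕ i → ¬ (S i ⊆ₑ unionBefore S i))

-- val(F, S) = |F ∪ ⋃ X_i| - m   (truncated subtraction; for proper sequences
-- |⋃ X_i| ≥ m, so it is never truncated)
valSeq : (n m : ℕ) → EdgeSet n → (Fin m → EdgeSet n) → ℕ
valSeq n m F S = ∣ F ∪ₑ unionAll S ∣ₑ ∸ m

IsValPk : (n k : ℕ) → EdgeSet n → ℕ → Set
IsValPk n k F v =
  Σ ℕ (λ m → Σ (Fin m → EdgeSet n) λ S → IsProperSeq n k m S × valSeq n m F S ≡ v) ×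
  (∀ m S → IsProperSeq n k m S → v ≤ valSeq n m F S)

-- The path 0 – 1 – ⋯ – k minus its last edge is a set B₀ of k-1 edges of K_n. Every edge of K_n is
-- reached from B₀ by repeatedly completing a copy of P_k whose other edges are already reached
-- (reverse a block of the path for an edge inside 0 … k, put a new end vertex after a relabelled
-- 0 … k-1 for the others). In a P_k-matroid each copy of P_k is a circuit of size k = |B₀| + 1, so
-- completion stays inside the span of the independent set B₀: every independent set has at most k-1
-- edges, and U_{k-1}, itself a P_k-matroid, is the maximum. The same completion process builds a proper
-- sequence covering E(K_n) in which every path adds one new edge, so val(F) ≤ k-1, while any proper
-- sequence of m ≥ 1 paths covers at least m + k - 1 edges; thus val_{P_k}(F) = min(|F|, k-1).

module Submission where

open import Defs
open import Data.Bool using (Bool; true; false; if_then_else_; _∧_; _∨_; not)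
open import Data.Bool.Properties
  using (∨-identityʳ; ∨-zeroʳ; ∨-assoc; ∧-conicalˡ; ∧-conicalʳ; T-≡)
open import Data.Nat using (ℕ; zero; suc; _+_; _≤_; _<_; _∸_; _≡ᵇ_; _<ᵇ_; z≤n; s≤s; z<s; s≤s⁻¹; pred; >-nonZero; _⊓_)
open import Data.Nat.Properties
open import Data.Fin using (Fin; toℕ; inject₁; fromℕ<; fromℕ) renaming (zero to fzero; suc to fsuc)
open import Data.Fin.Properties using (toℕ-injective; toℕ-inject₁; toℕ<n; toℕ-fromℕ<; toℕ-fromℕ)
  renaming (suc-injective to fsuc-injective)
open import Data.List using (List; []; _∷_; _++_; concatMap; allFin; tabulate)
open import Data.Bool.ListAction using (any)
open import Data.Vec.Functional using (init; last)
open import Data.Product using (Σ; _×_; _,_; proj₁; proj₂)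
open import Data.Sum using (_⊎_; inj₁; inj₂)
open import Data.Empty using (⊥-elim)
open import Relation.Nullary using (¬_; yes; no)
open import Relation.Binary.PropositionalEquality
open import Relation.Binary.Definitions using (tri<; tri≈; tri>)
open import Function.Definitions using (Injective)
open import Function using (case_of_)
open import Function.Bundles using (mk⇔; Equivalence)

true≢false : true ≢ false
true≢false ()

≡ᵇ⇒≡′ : ∀ {m n} → (m ≡ᵇ n) ≡ true → m ≡ n
≡ᵇ⇒≡′ {m} {n} h = ≡ᵇ⇒≡ m n (Equivalence.from T-≡ h)

≡ᵇ-refl : ∀ m → (m ≡ᵇ m) ≡ true
≡ᵇ-refl m = Equivalence.to T-≡ (≡⇒≡ᵇ m m refl)

≢⇒≡ᵇ-false : ∀ {m n} → m ≢ n → (m ≡ᵇ n) ≡ false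
≢⇒≡ᵇ-false {m} {n} m≢n with m ≡ᵇ n in eq
... | true = ⊥-elim (m≢n (≡ᵇ⇒≡′ eq))
... | false = refl

∨-true : ∀ {a b} → a ∨ b ≡ true → a ≡ true ⊎ b ≡ true
∨-true {true} _ = inj₁ refl
∨-true {false} h = inj₂ h

not-true : ∀ {b} → not b ≡ true → b ≡ false
not-true {false} _ = refl

not-false : ∀ {b} → not b ≡ false → b ≡ true
not-false {true} _ = refl

low high : ∀ {n} → Edge n → Fin n
low e = proj₁ (proj₁ e)
high e = proj₂ (proj₁ e)

edge-≡ : ∀ {n} (e e′ : Edge n) → toℕ (low e) ≡ toℕ (low e′) → toℕ (high e) ≡ toℕ (high e′) → e ≡ e′
edge-≡ ((i , j) , p) ((i′ , j′) , p′) l≡ h≡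
  with toℕ-injective {i = i} {j = i′} l≡ | toℕ-injective {i = j} {j = j′} h≡
... | refl | refl = cong (λ q → ((i , j) , q)) (<-irrelevant p p′)

==ₑ⇒≡ : ∀ {n} (e e′ : Edge n) → (e ==ₑ e′) ≡ true → e ≡ e′
==ₑ⇒≡ e e′ h =
  edge-≡ e e′ (≡ᵇ⇒≡′ (∧-conicalˡ _ _ h)) (≡ᵇ⇒≡′ (∧-conicalʳ (toℕ (low e) ≡ᵇ toℕ (low e′)) _ h))

==ₑ-refl : ∀ {n} (e : Edge n) → (e ==ₑ e) ≡ true
==ₑ-refl e rewrite ≡ᵇ-refl (toℕ (low e)) | ≡ᵇ-refl (toℕ (high e)) = refl

==ₑ-false⇒≢ : ∀ {n} (e e′ : Edge n) → (e ==ₑ e′) ≡ false → e ≢ e′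
==ₑ-false⇒≢ e .e h refl = true≢false (trans (sym (==ₑ-refl e)) h)

-- Counting edge sets

module _ {n : ℕ} where

  count-cong : ∀ {F G : EdgeSet n} → (∀ x → F x ≡ G x) → ∀ L → count F L ≡ count G L
  count-cong F≗G [] = refl
  count-cong {F} {G} F≗G (x ∷ L) rewrite F≗G x with G x
  ... | true = cong suc (count-cong F≗G L)
  ... | false = count-cong F≗G L

  count-mono : ∀ {F G : EdgeSet n} → F ⊆ₑ G → ∀ L → count F L ≤ count G L
  count-mono F⊆G [] = z≤n
  count-mono {F} {G} F⊆G (x ∷ L) with F x in Fx | G x in Gx
  ... | true | true = s≤s (count-mono F⊆G L)
  ... | true | false = ⊥-elim (true≢false (trans (sym (F⊆G x Fx)) Gx))
  ... | false | true = m≤n⇒m≤1+n (count-mono F⊆G L)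
  ... | false | false = count-mono F⊆G L

  count-∪-disjoint : ∀ {F G : EdgeSet n} → (∀ x → F x ≡ true → G x ≡ false) → ∀ L →
                     count (F ∪ₑ G) L ≡ count F L + count G L
  count-∪-disjoint disj [] = refl
  count-∪-disjoint {F} {G} disj (x ∷ L) with F x in Fx | G x in Gx
  ... | true | true = ⊥-elim (true≢false (trans (sym Gx) (disj x Fx)))
  ... | true | false = cong suc (count-∪-disjoint disj L)
  ... | false | true = trans (cong suc (count-∪-disjoint disj L)) (sym (+-suc _ _))
  ... | false | false = count-∪-disjoint disj L

  count-++ : ∀ (F : EdgeSet n) xs ys → count F (xs ++ ys) ≡ count F xs + count F ys
  count-++ F [] ys = refl
  count-++ F (x ∷ xs) ys with F x
  ... | true = cong suc (count-++ F xs ys)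
  ... | false = count-++ F xs ys

  count-∅ : ∀ L → count (∅ₑ {n}) L ≡ 0
  count-∅ [] = refl
  count-∅ (x ∷ L) = count-∅ L

  count-<⇒∈∖ : ∀ {F G : EdgeSet n} L → count F L < count G L →
               Σ (Edge n) λ e → G e ≡ true × F e ≡ false
  count-<⇒∈∖ {F} {G} (x ∷ L) lt with F x in Fx | G x in Gx
  ... | true | true = count-<⇒∈∖ L (s≤s⁻¹ lt)
  ... | true | false = count-<⇒∈∖ L (<-trans (n<1+n _) lt)
  ... | false | true = x , Gx , Fx
  ... | false | false = count-<⇒∈∖ L lt

module _ {n : ℕ} (P : EdgeSet n) {B : Set} (H : B → List (Edge n)) where

  count-concatMap-none : ∀ {m} (f : Fin m → B) → (∀ x → count P (H (f x)) ≡ 0) →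
                         count P (concatMap H (tabulate f)) ≡ 0
  count-concatMap-none {zero} f none = refl
  count-concatMap-none {suc m} f none = begin
    count P (H (f fzero) ++ concatMap H (tabulate (λ x → f (fsuc x))))
      ≡⟨ count-++ P (H (f fzero)) _ ⟩
    count P (H (f fzero)) + count P (concatMap H (tabulate (λ x → f (fsuc x))))
      ≡⟨ cong₂ _+_ (none fzero) (count-concatMap-none (λ x → f (fsuc x)) (λ x → none (fsuc x))) ⟩
    0 ∎
    where open ≡-Reasoning

  count-concatMap-single : ∀ {m} (f : Fin m → B) (x₀ : Fin m) → (∀ x → x ≢ x₀ → count P (H (f x)) ≡ 0) →
                           count P (concatMap H (tabulate f)) ≡ count P (H (f x₀))
  count-concatMap-single {suc m} f fzero others = begin
    count P (H (f fzero) ++ concatMap H (tabulate (λ x → f (fsuc x))))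
      ≡⟨ count-++ P (H (f fzero)) _ ⟩
    count P (H (f fzero)) + count P (concatMap H (tabulate (λ x → f (fsuc x))))
      ≡⟨ cong (count P (H (f fzero)) +_) (count-concatMap-none (λ x → f (fsuc x)) (λ x → others (fsuc x) λ ())) ⟩
    count P (H (f fzero)) + 0
      ≡⟨ +-identityʳ _ ⟩
    count P (H (f fzero)) ∎
    where open ≡-Reasoning
  count-concatMap-single {suc m} f (fsuc x₀) others = begin
    count P (H (f fzero) ++ concatMap H (tabulate (λ x → f (fsuc x))))
      ≡⟨ count-++ P (H (f fzero)) _ ⟩
    count P (H (f fzero)) + count P (concatMap H (tabulate (λ x → f (fsuc x))))
      ≡⟨ cong₂ _+_ (others fzero λ ()) (count-concatMap-single (λ x → f (fsuc x)) x₀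
                     (λ x x≢x₀ → others (fsuc x) (λ eq → x≢x₀ (fsuc-injective eq)))) ⟩
    count P (H (f (fsuc x₀))) ∎
    where open ≡-Reasoning

-- `Defs` keeps the inner generator of `allEdges` private; unification against the unfolding
-- of `allEdges` recovers it.
recoverGenerator : ∀ {F : ∀ {n} → Fin n → Fin n → List (Edge n)} →
                   (∀ n → concatMap (λ i → concatMap (F i) (allFin n)) (allFin n) ≡ allEdges n) →
                   ∀ {n} → Fin n → Fin n → List (Edge n)
recoverGenerator {F = F} _ = F

edgesFrom : ∀ {n} → Fin n → Fin n → List (Edge n)
edgesFrom = recoverGenerator (λ n → refl)

count-edgesFrom : ∀ {n} (e : Edge n) (i j : Fin n) →
  count (e ==ₑ_) (edgesFrom i j) ≡ (if (toℕ (low e) ≡ᵇ toℕ i) ∧ (toℕ (high e) ≡ᵇ toℕ j) then 1 else 0)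
count-edgesFrom e i j with toℕ i <? toℕ j
... | yes _ with (toℕ (low e) ≡ᵇ toℕ i) ∧ (toℕ (high e) ≡ᵇ toℕ j)
...   | true = refl
...   | false = refl
count-edgesFrom e i j | no i≮j with (toℕ (low e) ≡ᵇ toℕ i) in l≡ | (toℕ (high e) ≡ᵇ toℕ j) in h≡
...   | true | true = ⊥-elim (i≮j (subst₂ _<_ (≡ᵇ⇒≡′ l≡) (≡ᵇ⇒≡′ h≡) (proj₂ e)))
...   | true | false = refl
...   | false | true = refl
...   | false | false = refl

count-allEdges-single : ∀ {n} (e : Edge n) → count (e ==ₑ_) (allEdges n) ≡ 1
count-allEdges-single {n} e = begin
  count P (allEdges n)
    ≡⟨ count-concatMap-single P (λ i → concatMap (edgesFrom i) (allFin n)) (λ i → i) (low e) otherRow ⟩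
  count P (concatMap (edgesFrom (low e)) (allFin n))
    ≡⟨ count-concatMap-single P (edgesFrom (low e)) (λ j → j) (high e) otherColumn ⟩
  count P (edgesFrom (low e) (high e))
    ≡⟨ count-edgesFrom e (low e) (high e) ⟩
  (if (toℕ (low e) ≡ᵇ toℕ (low e)) ∧ (toℕ (high e) ≡ᵇ toℕ (high e)) then 1 else 0)
    ≡⟨ cong₂ (λ a b → if a ∧ b then 1 else 0) (≡ᵇ-refl (toℕ (low e))) (≡ᵇ-refl (toℕ (high e))) ⟩
  1 ∎
  where
  open ≡-Reasoning
  P : EdgeSet n
  P = e ==ₑ_
  otherColumn : ∀ j → j ≢ high e → count P (edgesFrom (low e) j) ≡ 0
  otherColumn j j≢ rewrite count-edgesFrom e (low e) j | ≡ᵇ-refl (toℕ (low e))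
                         | ≢⇒≡ᵇ-false (λ eq → j≢ (toℕ-injective (sym eq))) = refl
  otherRow : ∀ i → i ≢ low e → count P (concatMap (edgesFrom i) (allFin n)) ≡ 0
  otherRow i i≢ = count-concatMap-none P (edgesFrom i) (λ j → j) λ j →
    trans (count-edgesFrom e i j)
          (cong (λ a → if a ∧ (toℕ (high e) ≡ᵇ toℕ j) then 1 else 0)
                (≢⇒≡ᵇ-false (λ eq → i≢ (toℕ-injective (sym eq)))))

module _ {n : ℕ} (e : Edge n) (A : EdgeSet n) where

  insert-⊇ : A ⊆ₑ insertₑ e A
  insert-⊇ x Ax with e ==ₑ x
  ... | true = refl
  ... | false = Ax

  insert-cases : ∀ x → insertₑ e A x ≡ true → e ≡ x ⊎ A x ≡ true
  insert-cases x h with e ==ₑ x in eq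
  ... | true = inj₁ (==ₑ⇒≡ e x eq)
  ... | false = inj₂ h

  remove-cases : ∀ x → removeₑ e A x ≡ true → e ≢ x × A x ≡ true
  remove-cases x h with e ==ₑ x in eq
  ... | true = ⊥-elim (true≢false (sym h))
  ... | false = ==ₑ-false⇒≢ e x eq , h

  remove-keep : ∀ x → e ≢ x → A x ≡ true → removeₑ e A x ≡ true
  remove-keep x e≢x Ax with e ==ₑ x in eq
  ... | true = ⊥-elim (e≢x (==ₑ⇒≡ e x eq))
  ... | false = Ax

  ∣insert∣ : A e ≡ false → ∣ insertₑ e A ∣ₑ ≡ suc ∣ A ∣ₑ
  ∣insert∣ Ae = begin
    count (insertₑ e A) (allEdges n)  ≡⟨ count-cong split (allEdges n) ⟩
    count (A ∪ₑ (e ==ₑ_)) (allEdges n) ≡⟨ count-∪-disjoint disjoint (allEdges n) ⟩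
    ∣ A ∣ₑ + count (e ==ₑ_) (allEdges n) ≡⟨ cong (∣ A ∣ₑ +_) (count-allEdges-single e) ⟩
    ∣ A ∣ₑ + 1                          ≡⟨ +-comm _ 1 ⟩
    suc ∣ A ∣ₑ ∎
    where
    open ≡-Reasoning
    split : ∀ x → insertₑ e A x ≡ (A ∪ₑ (e ==ₑ_)) x
    split x with e ==ₑ x
    ... | true = sym (∨-zeroʳ _)
    ... | false = sym (∨-identityʳ _)
    disjoint : ∀ x → A x ≡ true → (e ==ₑ x) ≡ false
    disjoint x Ax with e ==ₑ x in eq
    ... | true = ⊥-elim (true≢false (trans (sym Ax) (trans (cong A (sym (==ₑ⇒≡ e x eq))) Ae)))
    ... | false = refl

∣remove∣ : ∀ {n} (e : Edge n) (C : EdgeSet n) → C e ≡ true → ∣ C ∣ₑ ≡ suc ∣ removeₑ e C ∣ₑ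
∣remove∣ {n} e C Ce = begin
  ∣ C ∣ₑ                           ≡⟨ count-cong reinsert (allEdges n) ⟩
  ∣ insertₑ e (removeₑ e C) ∣ₑ     ≡⟨ ∣insert∣ e (removeₑ e C) removed ⟩
  suc ∣ removeₑ e C ∣ₑ ∎
  where
  open ≡-Reasoning
  removed : removeₑ e C e ≡ false
  removed rewrite ==ₑ-refl e = refl
  reinsert : ∀ x → C x ≡ insertₑ e (removeₑ e C) x
  reinsert x with e ==ₑ x in eq
  ... | true = trans (cong C (sym (==ₑ⇒≡ e x eq))) Ce
  ... | false = refl

singleton-⊆ : ∀ {n} {F : EdgeSet n} e → F e ≡ true → (e ==ₑ_) ⊆ₑ F
singleton-⊆ {F = F} e Fe x e≡x = subst (λ y → F y ≡ true) (==ₑ⇒≡ e x e≡x) Fe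

findEdge : ∀ {n} (D : EdgeSet n) → (Σ (Edge n) λ x → D x ≡ true) ⊎ (∀ x → D x ≡ false)
findEdge {n} D with ∣ D ∣ₑ in ∣D∣
... | suc _ = let (x , Dx , _) = count-<⇒∈∖ {F = ∅ₑ} (allEdges n)
                                   (subst₂ _<_ (sym (count-∅ (allEdges n))) (sym ∣D∣) z<s)
              in inj₁ (x , Dx)
... | zero = inj₂ absent
  where
  absent : ∀ x → D x ≡ false
  absent x with D x in Dx
  ... | false = refl
  ... | true = ⊥-elim (1+n≰n (subst₂ _≤_ (count-allEdges-single x) ∣D∣
                               (count-mono (singleton-⊆ x Dx) (allEdges n))))

anyFin : ∀ m → (Fin m → Bool) → Bool
anyFin zero g = false
anyFin (suc m) g = g fzero ∨ anyFin m (λ i → g (fsuc i))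

any-tabulate : ∀ {m} {B : Set} (p : B → Bool) (f : Fin m → B) → any p (tabulate f) ≡ anyFin m (λ i → p (f i))
any-tabulate {zero} p f = refl
any-tabulate {suc m} p f = cong (p (f fzero) ∨_) (any-tabulate p (λ i → f (fsuc i)))

anyFin-sound : ∀ m g → anyFin m g ≡ true → Σ (Fin m) λ i → g i ≡ true
anyFin-sound (suc m) g h with g fzero in g0
... | true = fzero , g0
... | false = let (i , gi) = anyFin-sound m (λ i → g (fsuc i)) h in fsuc i , gi

anyFin-complete : ∀ m g i → g i ≡ true → anyFin m g ≡ true
anyFin-complete (suc m) g fzero gi rewrite gi = refl
anyFin-complete (suc m) g (fsuc i) gi rewrite anyFin-complete m (λ i → g (fsuc i)) i gi = ∨-zeroʳ _

anyFin-cong : ∀ m {g h : Fin m → Bool} → (∀ i → g i ≡ h i) → anyFin m g ≡ anyFin m h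
anyFin-cong zero _ = refl
anyFin-cong (suc m) g≗h = cong₂ _∨_ (g≗h fzero) (anyFin-cong m (λ i → g≗h (fsuc i)))

anyFin-snoc : ∀ m g → anyFin (suc m) g ≡ anyFin m (λ i → g (inject₁ i)) ∨ g (fromℕ m)
anyFin-snoc zero g = ∨-identityʳ _
anyFin-snoc (suc m) g =
  trans (cong (g fzero ∨_) (anyFin-snoc m (λ i → g (fsuc i)))) (sym (∨-assoc (g fzero) _ _))

-- Paths

edgeBetween : ∀ {n} (a b : Fin n) → toℕ a ≢ toℕ b → Edge n
edgeBetween a b a≢b with <-cmp (toℕ a) (toℕ b)
... | tri< a<b _ _ = (a , b) , a<b
... | tri≈ _ a≡b _ = ⊥-elim (a≢b a≡b)
... | tri> _ _ b<a = (b , a) , b<a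

edgeBetween-joins : ∀ {n} (a b : Fin n) (a≢b : toℕ a ≢ toℕ b) → Joins (edgeBetween a b a≢b) a b
edgeBetween-joins a b a≢b with <-cmp (toℕ a) (toℕ b)
... | tri< _ _ _ = inj₁ (refl , refl)
... | tri≈ _ a≡b _ = ⊥-elim (a≢b a≡b)
... | tri> _ _ _ = inj₂ (refl , refl)

joins⇒≡edgeBetween : ∀ {n} (e : Edge n) (a b : Fin n) (a≢b : toℕ a ≢ toℕ b) →
                     Joins e a b → e ≡ edgeBetween a b a≢b
joins⇒≡edgeBetween ((i , j) , p) a b a≢b J with <-cmp (toℕ a) (toℕ b)
joins⇒≡edgeBetween ((i , j) , p) .i .j _ (inj₁ (refl , refl)) | tri< i<j _ _ =
  cong (λ q → ((i , j) , q)) (<-irrelevant p i<j)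
joins⇒≡edgeBetween ((i , j) , p) .j .i _ (inj₂ (refl , refl)) | tri< j<i _ _ = ⊥-elim (<-asym p j<i)
... | tri≈ _ a≡b _ = ⊥-elim (a≢b a≡b)
joins⇒≡edgeBetween ((i , j) , p) .i .j _ (inj₁ (refl , refl)) | tri> _ _ j<i = ⊥-elim (<-asym p j<i)
joins⇒≡edgeBetween ((i , j) , p) .j .i _ (inj₂ (refl , refl)) | tri> _ _ i<j =
  cong (λ q → ((i , j) , q)) (<-irrelevant p i<j)

joins-endpoints : ∀ {n} (e : Edge n) {a b c d : Fin n} → Joins e a b → Joins e c d →
                  (a ≡ c × b ≡ d) ⊎ (a ≡ d × b ≡ c)
joins-endpoints _ (inj₁ (refl , refl)) (inj₁ (refl , refl)) = inj₁ (refl , refl)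
joins-endpoints _ (inj₁ (refl , refl)) (inj₂ (refl , refl)) = inj₂ (refl , refl)
joins-endpoints _ (inj₂ (refl , refl)) (inj₁ (refl , refl)) = inj₂ (refl , refl)
joins-endpoints _ (inj₂ (refl , refl)) (inj₂ (refl , refl)) = inj₁ (refl , refl)

-- Joins on vertex numbers, so that paths can be given as maps ℕ → ℕ.
Joinsℕ : ∀ {n} → Edge n → ℕ → ℕ → Set
Joinsℕ e a b = (toℕ (low e) ≡ a × toℕ (high e) ≡ b) ⊎ (toℕ (low e) ≡ b × toℕ (high e) ≡ a)

Joinsℕ-sym : ∀ {n} {e : Edge n} {a b} → Joinsℕ e a b → Joinsℕ e b a
Joinsℕ-sym (inj₁ p) = inj₂ p
Joinsℕ-sym (inj₂ p) = inj₁ p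

Joinsℕ-unique : ∀ {n} (e e′ : Edge n) {a b} → Joinsℕ e a b → Joinsℕ e′ a b → e ≡ e′
Joinsℕ-unique e e′ (inj₁ (l , h)) (inj₁ (l′ , h′)) = edge-≡ e e′ (trans l (sym l′)) (trans h (sym h′))
Joinsℕ-unique e e′ (inj₂ (l , h)) (inj₂ (l′ , h′)) = edge-≡ e e′ (trans l (sym l′)) (trans h (sym h′))
Joinsℕ-unique e e′ (inj₁ (l , h)) (inj₂ (l′ , h′)) =
  ⊥-elim (<-asym (subst₂ _<_ l h (proj₂ e)) (subst₂ _<_ l′ h′ (proj₂ e′)))
Joinsℕ-unique e e′ (inj₂ (l , h)) (inj₁ (l′ , h′)) =
  ⊥-elim (<-asym (subst₂ _<_ l h (proj₂ e)) (subst₂ _<_ l′ h′ (proj₂ e′)))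

joinsᵇ : ∀ {n} → Edge n → Fin n → Fin n → Bool
joinsᵇ e a b = ((toℕ (low e) ≡ᵇ toℕ a) ∧ (toℕ (high e) ≡ᵇ toℕ b))
             ∨ ((toℕ (low e) ≡ᵇ toℕ b) ∧ (toℕ (high e) ≡ᵇ toℕ a))

joinsᵇ⇒Joinsℕ : ∀ {n} (e : Edge n) a b → joinsᵇ e a b ≡ true → Joinsℕ e (toℕ a) (toℕ b)
joinsᵇ⇒Joinsℕ e a b h with ∨-true {(toℕ (low e) ≡ᵇ toℕ a) ∧ (toℕ (high e) ≡ᵇ toℕ b)} h
... | inj₁ h₁ = inj₁ (≡ᵇ⇒≡′ (∧-conicalˡ _ _ h₁) , ≡ᵇ⇒≡′ (∧-conicalʳ (toℕ (low e) ≡ᵇ toℕ a) _ h₁))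
... | inj₂ h₂ = inj₂ (≡ᵇ⇒≡′ (∧-conicalˡ _ _ h₂) , ≡ᵇ⇒≡′ (∧-conicalʳ (toℕ (low e) ≡ᵇ toℕ b) _ h₂))

Joinsℕ⇒joinsᵇ : ∀ {n} (e : Edge n) a b → Joinsℕ e (toℕ a) (toℕ b) → joinsᵇ e a b ≡ true
Joinsℕ⇒joinsᵇ e a b (inj₁ (l , h)) rewrite l | h | ≡ᵇ-refl (toℕ a) | ≡ᵇ-refl (toℕ b) = refl
Joinsℕ⇒joinsᵇ e a b (inj₂ (l , h)) rewrite l | h | ≡ᵇ-refl (toℕ a) | ≡ᵇ-refl (toℕ b) = ∨-zeroʳ _

Joins⇒Joinsℕ : ∀ {n} {e : Edge n} {a b} → Joins e a b → Joinsℕ e (toℕ a) (toℕ b)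
Joins⇒Joinsℕ (inj₁ (refl , refl)) = inj₁ (refl , refl)
Joins⇒Joinsℕ (inj₂ (refl , refl)) = inj₂ (refl , refl)

Joinsℕ⇒Joins : ∀ {n} {e : Edge n} {a b} → Joinsℕ e (toℕ a) (toℕ b) → Joins e a b
Joinsℕ⇒Joins (inj₁ (l , h)) = inj₁ (toℕ-injective l , toℕ-injective h)
Joinsℕ⇒Joins (inj₂ (l , h)) = inj₂ (toℕ-injective l , toℕ-injective h)

pathEdges : ∀ {n k} → (Fin (suc k) → Fin n) → EdgeSet n
pathEdges {k = k} v e = anyFin k (λ i → joinsᵇ e (v (inject₁ i)) (v (fsuc i)))

module _ {n k : ℕ} (v : Fin (suc k) → Fin n) where

  pathEdges-∋ : ∀ e i → Joinsℕ e (toℕ (v (inject₁ i))) (toℕ (v (fsuc i))) → pathEdges v e ≡ true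
  pathEdges-∋ e i J = anyFin-complete k _ i (Joinsℕ⇒joinsᵇ e _ _ J)

  pathEdges-∈ : ∀ e → pathEdges v e ≡ true → Σ (Fin k) λ i → Joinsℕ e (toℕ (v (inject₁ i))) (toℕ (v (fsuc i)))
  pathEdges-∈ e h = let (i , J) = anyFin-sound k _ h in i , joinsᵇ⇒Joinsℕ e _ _ J

  pathEdges-isPath : Injective _≡_ _≡_ v → IsPathEdgeSet n k (pathEdges v)
  pathEdges-isPath v-inj = v , v-inj , λ e → mk⇔
    (λ h → let (i , J) = pathEdges-∈ e h in i , Joinsℕ⇒Joins {e = e} J)
    (λ (i , J) → pathEdges-∋ e i (Joins⇒Joinsℕ {e = e} J))

∣image∣ : ∀ {n} k (f : Fin k → Edge n) → Injective _≡_ _≡_ f → (X : EdgeSet n) →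
          (∀ e → X e ≡ true → Σ (Fin k) λ i → e ≡ f i) → (∀ i → X (f i) ≡ true) → ∣ X ∣ₑ ≡ k
∣image∣ {n} zero f f-inj X X⊆f _ = trans (count-cong empty (allEdges n)) (count-∅ (allEdges n))
  where
  empty : ∀ x → X x ≡ ∅ₑ x
  empty x with X x in Xx
  ... | true = case X⊆f x Xx of λ ()
  ... | false = refl
∣image∣ {n} (suc k) f f-inj X X⊆f f⊆X =
  trans (∣remove∣ (f fzero) X (f⊆X fzero))
        (cong suc (∣image∣ k (λ i → f (fsuc i)) (λ eq → fsuc-injective (f-inj eq)) X′ X′⊆f X′∋f))
  where
  X′ : EdgeSet n
  X′ = removeₑ (f fzero) X
  X′⊆f : ∀ e → X′ e ≡ true → Σ (Fin k) λ i → e ≡ f (fsuc i)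
  X′⊆f e h with remove-cases (f fzero) X e h
  ... | f0≢e , Xe with X⊆f e Xe
  ...   | fzero , refl = ⊥-elim (f0≢e refl)
  ...   | fsuc i , e≡ = i , e≡
  X′∋f : ∀ i → X′ (f (fsuc i)) ≡ true
  X′∋f i = remove-keep (f fzero) X (f (fsuc i)) (λ eq → case f-inj eq of λ ()) (f⊆X (fsuc i))

consecutive-distinct : ∀ {n k} (v : Fin (suc k) → Fin n) → Injective _≡_ _≡_ v →
                       ∀ i → toℕ (v (inject₁ i)) ≢ toℕ (v (fsuc i))
consecutive-distinct v v-inj i eq = <-irrefl (cong toℕ (v-inj (toℕ-injective eq))) i<1+i
  where
  i<1+i : toℕ (inject₁ i) < toℕ (fsuc i)
  i<1+i = subst (_< suc (toℕ i)) (sym (toℕ-inject₁ i)) (n<1+n (toℕ i))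

∣path∣ : ∀ {n k} (X : EdgeSet n) → IsPathEdgeSet n k X → ∣ X ∣ₑ ≡ k
∣path∣ {n} {k} X (v , v-inj , X⇔) = ∣image∣ k step step-inj X X⊆steps steps⊆X
  where
  distinct : ∀ i → toℕ (v (inject₁ i)) ≢ toℕ (v (fsuc i))
  distinct = consecutive-distinct v v-inj
  step : Fin k → Edge n
  step i = edgeBetween (v (inject₁ i)) (v (fsuc i)) (distinct i)
  step-joins : ∀ i → Joins (step i) (v (inject₁ i)) (v (fsuc i))
  step-joins i = edgeBetween-joins _ _ (distinct i)
  step-inj : Injective _≡_ _≡_ step
  step-inj {i} {j} eq with joins-endpoints (step i) (step-joins i) (subst (λ e → Joins e _ _) (sym eq) (step-joins j))
  ... | inj₁ (same , _) = toℕ-injective (trans (sym (toℕ-inject₁ i)) (trans (cong toℕ (v-inj same)) (toℕ-inject₁ j)))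
  ... | inj₂ (crossed₁ , crossed₂) = ⊥-elim (<-asym j<i i<j)
    where
    j<i : toℕ j < toℕ i
    j<i = subst (toℕ j <_) (sym (trans (sym (toℕ-inject₁ i)) (cong toℕ (v-inj crossed₁)))) (n<1+n _)
    i<j : toℕ i < toℕ j
    i<j = subst (toℕ i <_) (trans (cong toℕ (v-inj crossed₂)) (toℕ-inject₁ j)) (n<1+n _)
  X⊆steps : ∀ e → X e ≡ true → Σ (Fin k) λ i → e ≡ step i
  X⊆steps e Xe = let (i , J) = Equivalence.to (X⇔ e) Xe in i , joins⇒≡edgeBetween e _ _ (distinct i) J
  steps⊆X : ∀ i → X (step i) ≡ true
  steps⊆X i = Equivalence.from (X⇔ (step i)) (i , step-joins i)

reverseSegment : ℕ → ℕ → ℕ → ℕ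
reverseSegment a b i with i ≤? a
... | yes _ = i
... | no _ with i ≤? b
...   | yes _ = suc (a + b) ∸ i
...   | no _ = i

module _ (a b : ℕ) where

  reverseSegment-low : ∀ i → i ≤ a → reverseSegment a b i ≡ i
  reverseSegment-low i i≤a with i ≤? a
  ... | yes _ = refl
  ... | no i≰a = ⊥-elim (i≰a i≤a)

  reverseSegment-mid : ∀ i → a < i → i ≤ b → reverseSegment a b i ≡ suc (a + b) ∸ i
  reverseSegment-mid i a<i i≤b with i ≤? a
  ... | yes i≤a = ⊥-elim (<⇒≱ a<i i≤a)
  ... | no _ with i ≤? b
  ...   | yes _ = refl
  ...   | no i≰b = ⊥-elim (i≰b i≤b)

  reverseSegment-high : ∀ i → b < i → reverseSegment a b i ≡ i
  reverseSegment-high i b<i with i ≤? a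
  ... | yes _ = refl
  ... | no _ with i ≤? b
  ...   | yes i≤b = ⊥-elim (<⇒≱ b<i i≤b)
  ...   | no _ = refl

  mirror-≤ : ∀ i → a < i → suc (a + b) ∸ i ≤ b
  mirror-≤ i a<i = m≤n+o⇒m∸n≤o (suc (a + b)) i (+-monoˡ-≤ b a<i)

  mirror-> : ∀ i → i ≤ b → a < suc (a + b) ∸ i
  mirror-> i i≤b = m+n≤o⇒m≤o∸n (suc a) (s≤s (+-monoʳ-≤ a i≤b))

  data SegmentView (i : ℕ) : Set where
    before  : i ≤ a → reverseSegment a b i ≡ i → SegmentView i
    inside  : a < i → i ≤ b → reverseSegment a b i ≡ suc (a + b) ∸ i → SegmentView i
    after : b < i → reverseSegment a b i ≡ i → SegmentView i

  segmentView : ∀ i → SegmentView i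
  segmentView i with i ≤? a
  ... | yes i≤a = before i≤a (reverseSegment-low i i≤a)
  ... | no i≰a with i ≤? b
  ...   | yes i≤b = inside (≰⇒> i≰a) i≤b (reverseSegment-mid i (≰⇒> i≰a) i≤b)
  ...   | no i≰b = after (≰⇒> i≰b) (reverseSegment-high i (≰⇒> i≰b))

  module _ (a<b : a < b) where

    reverseSegment-injective : ∀ i j → reverseSegment a b i ≡ reverseSegment a b j → i ≡ j
    reverseSegment-injective i j eq with segmentView i | segmentView j
    ... | before _ ri | before _ rj = trans (sym ri) (trans eq rj)
    ... | before i≤a ri | inside _ j≤b rj = ⊥-elim (<⇒≱ (mirror-> j j≤b) (subst (_≤ a) (trans (sym ri) (trans eq rj)) i≤a))
    ... | before i≤a ri | after b<j rj = ⊥-elim (<⇒≱ (<-trans a<b b<j) (subst (_≤ a) (trans (sym ri) (trans eq rj)) i≤a))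
    ... | inside _ i≤b ri | before j≤a rj = ⊥-elim (<⇒≱ (mirror-> i i≤b) (subst (_≤ a) (trans (sym rj) (trans (sym eq) ri)) j≤a))
    ... | inside _ i≤b ri | inside _ j≤b rj =
      ∸-cancelˡ-≡ (below i≤b) (below j≤b) (trans (sym ri) (trans eq rj))
      where
      below : ∀ {x} → x ≤ b → x ≤ suc (a + b)
      below x≤b = m≤n⇒m≤1+n (≤-trans x≤b (m≤n+m b a))
    ... | inside a<i _ ri | after b<j rj = ⊥-elim (<⇒≱ b<j (subst (_≤ b) (trans (sym ri) (trans eq rj)) (mirror-≤ i a<i)))
    ... | after b<i ri | before j≤a rj = ⊥-elim (<⇒≱ (<-trans a<b b<i) (subst (_≤ a) (trans (sym rj) (trans (sym eq) ri)) j≤a))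
    ... | after b<i ri | inside a<j _ rj = ⊥-elim (<⇒≱ b<i (subst (_≤ b) (trans (sym rj) (trans (sym eq) ri)) (mirror-≤ j a<j)))
    ... | after _ ri | after _ rj = trans (sym ri) (trans eq rj)

    reverseSegment-≤ : ∀ {i K} → b ≤ K → i ≤ K → reverseSegment a b i ≤ K
    reverseSegment-≤ {i} {K} b≤K i≤K with segmentView i
    ... | before _ ri = subst (_≤ K) (sym ri) i≤K
    ... | inside a<i _ ri = subst (_≤ K) (sym ri) (≤-trans (mirror-≤ i a<i) b≤K)
    ... | after _ ri = subst (_≤ K) (sym ri) i≤K

swap : ℕ → ℕ → ℕ → ℕ
swap a c i with i ≟ a
... | yes _ = c
... | no _ with i ≟ c
...   | yes _ = a
...   | no _ = i

module _ (a c : ℕ) where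

  swap-left : swap a c a ≡ c
  swap-left with a ≟ a
  ... | yes _ = refl
  ... | no a≢a = ⊥-elim (a≢a refl)

  swap-right : swap a c c ≡ a
  swap-right with c ≟ a
  ... | yes c≡a = c≡a
  ... | no _ with c ≟ c
  ...   | yes _ = refl
  ...   | no c≢c = ⊥-elim (c≢c refl)

  swap-other : ∀ i → i ≢ a → i ≢ c → swap a c i ≡ i
  swap-other i i≢a i≢c with i ≟ a
  ... | yes i≡a = ⊥-elim (i≢a i≡a)
  ... | no _ with i ≟ c
  ...   | yes i≡c = ⊥-elim (i≢c i≡c)
  ...   | no _ = refl

  swap-involutive : ∀ i → swap a c (swap a c i) ≡ i
  swap-involutive i with i ≟ a
  ... | yes refl = swap-right
  ... | no i≢a with i ≟ c
  ...   | yes refl = swap-left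
  ...   | no i≢c = swap-other i i≢a i≢c

  swap-injective : ∀ i j → swap a c i ≡ swap a c j → i ≡ j
  swap-injective i j eq = trans (sym (swap-involutive i)) (trans (cong (swap a c) eq) (swap-involutive j))

  swap-< : ∀ {i B} → a < B → c < B → i < B → swap a c i < B
  swap-< {i} a<B c<B i<B with i ≟ a
  ... | yes _ = c<B
  ... | no _ with i ≟ c
  ...   | yes _ = a<B
  ...   | no _ = i<B

swapThenTo : ℕ → ℕ → ℕ → ℕ → ℕ → ℕ
swapThenTo k b a c i with i ≟ k
... | yes _ = b
... | no _ = swap a c i

module _ (k b a c : ℕ) where

  swapThenTo-end : swapThenTo k b a c k ≡ b
  swapThenTo-end with k ≟ k
  ... | yes _ = refl
  ... | no k≢k = ⊥-elim (k≢k refl)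

  swapThenTo-other : ∀ i → i ≢ k → swapThenTo k b a c i ≡ swap a c i
  swapThenTo-other i i≢k with i ≟ k
  ... | yes i≡k = ⊥-elim (i≢k i≡k)
  ... | no _ = refl

  swapThenTo-cases : ∀ i → (i ≡ k × swapThenTo k b a c i ≡ b) ⊎ (i ≢ k × swapThenTo k b a c i ≡ swap a c i)
  swapThenTo-cases i with i ≟ k
  ... | yes i≡k = inj₁ (i≡k , refl)
  ... | no i≢k = inj₂ (i≢k , refl)

  module _ (a<b : a < b) (c<b : c < b) (k<b : k < b) where

    swap<b : ∀ {i} → i ≤ k → swap a c i < b
    swap<b i≤k = swap-< a c a<b c<b (≤-<-trans i≤k k<b)

    swapThenTo-≤ : ∀ i → i ≤ k → swapThenTo k b a c i ≤ b
    swapThenTo-≤ i i≤k with swapThenTo-cases i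
    ... | inj₁ (_ , σi≡b) = ≤-reflexive σi≡b
    ... | inj₂ (_ , σi≡) = subst (_≤ b) (sym σi≡) (<⇒≤ (swap<b i≤k))

    swapThenTo-injective : ∀ i j → i ≤ k → j ≤ k → swapThenTo k b a c i ≡ swapThenTo k b a c j → i ≡ j
    swapThenTo-injective i j i≤k j≤k eq with swapThenTo-cases i | swapThenTo-cases j
    ... | inj₁ (i≡k , _) | inj₁ (j≡k , _) = trans i≡k (sym j≡k)
    ... | inj₁ (_ , σi≡b) | inj₂ (_ , σj≡) = ⊥-elim (<-irrefl (trans (sym σj≡) (trans (sym eq) σi≡b)) (swap<b j≤k))
    ... | inj₂ (_ , σi≡) | inj₁ (_ , σj≡b) = ⊥-elim (<-irrefl (trans (sym σi≡) (trans eq σj≡b)) (swap<b i≤k))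
    ... | inj₂ (_ , σi≡) | inj₂ (_ , σj≡) = swap-injective a c i j (trans (sym σi≡) (trans eq σj≡))

-- Closure under path completion

PathClosed : (n k : ℕ) → (Edge n → Set) → Set
PathClosed n k G = ∀ X → IsPathEdgeSet n k X → ∀ e → X e ≡ true →
                   (∀ e′ → X e′ ≡ true → e′ ≢ e → G e′) → G e

module PathClosure {n k : ℕ} (k≥1 : 1 ≤ k) (k<n : k < n) (G : Edge n → Set)
  (initial : ∀ i → suc (suc i) ≤ k → ∀ e → Joinsℕ e i (suc i) → G e)
  (closed : PathClosed n k G) where

  Good : ℕ → ℕ → Set
  Good a b = ∀ e → Joinsℕ e a b → G e

  Good-sym : ∀ {a b} → Good a b → Good b a
  Good-sym good e J = good e (Joinsℕ-sym {e = e} J)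

  completeAlong : (v : ℕ → ℕ) → (∀ i → i ≤ k → v i < n) → (∀ i j → i ≤ k → j ≤ k → v i ≡ v j → i ≡ j) →
             ∀ t → t < k → (∀ i → i < k → i ≢ t → Good (v i) (v (suc i))) → Good (v t) (v (suc t))
  completeAlong v v<n v-inj t t<k others e Je = closed (pathEdges w) (pathEdges-isPath w w-inj) e (pathEdges-∋ w e t′ Je′) others′
    where
    index≤k : (i : Fin (suc k)) → toℕ i ≤ k
    index≤k i = s≤s⁻¹ (toℕ<n i)
    w : Fin (suc k) → Fin n
    w i = fromℕ< (v<n (toℕ i) (index≤k i))
    toℕ-w : ∀ i → toℕ (w i) ≡ v (toℕ i)
    toℕ-w i = toℕ-fromℕ< _
    w-inj : Injective _≡_ _≡_ w
    w-inj {i} {j} eq = toℕ-injective (v-inj _ _ (index≤k i) (index≤k j) (trans (sym (toℕ-w i)) (trans (cong toℕ eq) (toℕ-w j))))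
    step-joins : ∀ {e′} (i : Fin k) → Joinsℕ e′ (toℕ (w (inject₁ i))) (toℕ (w (fsuc i))) → Joinsℕ e′ (v (toℕ i)) (v (suc (toℕ i)))
    step-joins {e′} i = subst₂ (Joinsℕ e′) (trans (toℕ-w _) (cong v (toℕ-inject₁ i))) (toℕ-w (fsuc i))
    t′ : Fin k
    t′ = fromℕ< t<k
    Je′ : Joinsℕ e (toℕ (w (inject₁ t′))) (toℕ (w (fsuc t′)))
    Je′ = subst₂ (Joinsℕ e) (sym (trans (toℕ-w _) (cong v (trans (toℕ-inject₁ t′) (toℕ-fromℕ< t<k)))))
                            (sym (trans (toℕ-w (fsuc t′)) (cong (λ z → v (suc z)) (toℕ-fromℕ< t<k)))) Je
    others′ : ∀ e′ → pathEdges w e′ ≡ true → e′ ≢ e → G e′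
    others′ e′ on e′≢e with pathEdges-∈ w e′ on
    ... | i , J with toℕ i ≟ t
    ...   | yes refl = ⊥-elim (e′≢e (Joinsℕ-unique e′ e (step-joins {e′} i J) Je))
    ...   | no i≢t = others (toℕ i) (toℕ<n i) i≢t e′ (step-joins {e′} i J)

  consecutive : ∀ i → suc i ≤ k → Good i (suc i)
  consecutive i i<k with suc (suc i) ≤? k
  ... | yes 1+i<k = initial i 1+i<k
  ... | no 1+i≮k = completeAlong (λ x → x) (λ x x≤k → ≤-<-trans x≤k k<n) (λ _ _ _ _ eq → eq) i i<k earlier
    where
    earlier : ∀ j → j < k → j ≢ i → Good j (suc j)
    earlier j j<k j≢i = initial j (≤∧≢⇒< j<k (λ eq → j≢i (suc-injective (trans eq (sym (≤-antisym i<k (≮⇒≥ 1+i≮k)))))))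

  -- Reversing the block a+1 … b of the path 0 – ⋯ – k turns the edge {a, a+1} into {a, b};
  -- all other edges of the new path are edges of the old one, except {a+1, b+1} when b < k.
  reversal : ∀ {a b} → a < b → b ≤ k → (b < k → Good (suc a) (suc b)) → Good a b
  reversal {a} {b} a<b b≤k shifted =
    subst₂ Good (reverseSegment-low a b a ≤-refl)
                (trans (reverseSegment-mid a b (suc a) (n<1+n a) a<b) (m+n∸m≡n a b))
                (completeAlong (reverseSegment a b) bounded (λ i j _ _ → reverseSegment-injective a b a<b i j)
                          a (<-≤-trans a<b b≤k) others)
    where
    ρ : ℕ → ℕ
    ρ = reverseSegment a b
    bounded : ∀ i → i ≤ k → ρ i < n
    bounded i i≤k = ≤-<-trans (reverseSegment-≤ a b a<b b≤k i≤k) k<n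
    others : ∀ i → i < k → i ≢ a → Good (ρ i) (ρ (suc i))
    others i i<k i≢a with <-cmp i a
    ... | tri< i<a _ _ =
      subst₂ Good (sym (reverseSegment-low a b i (<⇒≤ i<a))) (sym (reverseSegment-low a b (suc i) i<a)) (consecutive i i<k)
    ... | tri≈ _ i≡a _ = ⊥-elim (i≢a i≡a)
    ... | tri> _ _ a<i with <-cmp i b
    ...   | tri< i<b _ _ = subst₂ Good (sym ρi≡) (sym ρ1+i≡) (Good-sym (consecutive w (≤-trans (subst (_≤ b) ρi≡ ρi≤b) b≤k)))
      where
      w : ℕ
      w = (a + b) ∸ i
      ρi≤b : ρ i ≤ b
      ρi≤b = subst (_≤ b) (sym (reverseSegment-mid a b i a<i (<⇒≤ i<b))) (mirror-≤ a b i a<i)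
      ρi≡ : ρ i ≡ suc w
      ρi≡ = trans (reverseSegment-mid a b i a<i (<⇒≤ i<b)) (+-∸-assoc 1 (≤-trans (<⇒≤ i<b) (m≤n+m b a)))
      ρ1+i≡ : ρ (suc i) ≡ w
      ρ1+i≡ = reverseSegment-mid a b (suc i) (m<n⇒m<1+n a<i) i<b
    ...   | tri≈ _ refl _ =
      subst₂ Good (sym (trans (reverseSegment-mid a b b a<b ≤-refl) (m+n∸n≡m (suc a) b)))
                  (sym (reverseSegment-high a b (suc b) (n<1+n b))) (shifted i<k)
    ...   | tri> _ _ b<i =
      subst₂ Good (sym (reverseSegment-high a b i b<i)) (sym (reverseSegment-high a b (suc i) (m<n⇒m<1+n b<i)))
                  (consecutive i i<k)

  withinPath : ∀ d {a b} → a < b → b + d ≡ k → Good a b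
  withinPath d {a} {b} a<b b+d≡k with suc a ≟ b
  ... | yes refl = consecutive a (subst (b ≤_) b+d≡k (m≤m+n b d))
  ... | no _ = reversal a<b (subst (b ≤_) b+d≡k (m≤m+n b d)) (shifted d b+d≡k)
    where
    shifted : ∀ d → b + d ≡ k → b < k → Good (suc a) (suc b)
    shifted zero b+0≡k b<k = ⊥-elim (<-irrefl (trans (sym (+-identityʳ b)) b+0≡k) b<k)
    shifted (suc d) b+1+d≡k _ = withinPath d (s≤s a<b) (trans (sym (+-suc b d)) b+1+d≡k)

  -- For b > k, the path through a relabelling of 0 … k-1 ending in a, followed by b, has {a, b} as its
  -- last edge and all other edges between vertices below b.
  swapping : ∀ {a b} → a < b → k < b → b < n → (∀ x y → x < b → y < b → x ≢ y → Good x y) → Good a b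
  swapping {a} {b} a<b k<b b<n below =
    subst₂ Good (trans (swapThenTo-other k b a c c c≢k) (swap-right a c))
                (trans (cong σ 1+c≡k) (swapThenTo-end k b a c))
                (completeAlong σ (λ i i≤k → ≤-<-trans (swapThenTo-≤ k b a c a<b c<b k<b i i≤k) b<n)
                          (swapThenTo-injective k b a c a<b c<b k<b) c c<k others)
    where
    c : ℕ
    c = pred k
    σ : ℕ → ℕ
    σ = swapThenTo k b a c
    1+c≡k : suc c ≡ k
    1+c≡k = suc-pred k {{>-nonZero k≥1}}
    c<k : c < k
    c<k = subst (c <_) 1+c≡k (n<1+n c)
    c≢k : c ≢ k
    c≢k c≡k = <-irrefl c≡k c<k
    c<b : c < b
    c<b = <-trans c<k k<b
    others : ∀ i → i < k → i ≢ c → Good (σ i) (σ (suc i))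
    others i i<k i≢c =
      subst₂ Good (sym (swapThenTo-other k b a c i i≢k)) (sym (swapThenTo-other k b a c (suc i) 1+i≢k))
             (below _ _ (swap<b k b a c a<b c<b k<b (<⇒≤ i<k)) (swap<b k b a c a<b c<b k<b i<k)
                    (λ eq → <-irrefl (swap-injective a c i (suc i) eq) (n<1+n i)))
      where
      i≢k : i ≢ k
      i≢k i≡k = <-irrefl i≡k i<k
      1+i≢k : suc i ≢ k
      1+i≢k eq = i≢c (suc-injective (trans eq (sym 1+c≡k)))

  everyPair : ∀ B {a b} → b ≤ B → a < b → b < n → Good a b
  everyPair zero b≤0 a<b _ = ⊥-elim (<⇒≱ (<-≤-trans a<b b≤0) z≤n)
  everyPair (suc B) {a} {b} b≤1+B a<b b<n with b ≤? k
  ... | yes b≤k = withinPath (k ∸ b) a<b (m+[n∸m]≡n b≤k)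
  ... | no b≰k = swapping a<b (≰⇒> b≰k) b<n below
    where
    below : ∀ x y → x < b → y < b → x ≢ y → Good x y
    below x y x<b y<b x≢y with <-cmp x y
    ... | tri< x<y _ _ = everyPair B (s≤s⁻¹ (<-≤-trans y<b b≤1+B)) x<y (<-trans y<b b<n)
    ... | tri≈ _ x≡y _ = ⊥-elim (x≢y x≡y)
    ... | tri> _ _ y<x = Good-sym (everyPair B (s≤s⁻¹ (<-≤-trans x<b b≤1+B)) y<x (<-trans x<b b<n))

  total : ∀ e → G e
  total e = everyPair n (<⇒≤ (toℕ<n (high e))) (proj₂ e) (toℕ<n (high e)) e (inj₁ (refl , refl))

-- Matroids

module MatroidFacts {n : ℕ} {Ind : EdgeSet n → Set} (M : IsMatroid n Ind) where
  open IsMatroid M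

  augmentTo : ∀ d {A J} → Ind A → Ind J → ∣ A ∣ₑ + d ≡ ∣ J ∣ₑ →
              Σ (EdgeSet n) λ K → Ind K × A ⊆ₑ K × K ⊆ₑ (A ∪ₑ J) × ∣ K ∣ₑ ≡ ∣ J ∣ₑ
  augmentTo zero {A} indA _ ∣A∣+0≡∣J∣ =
    A , indA , (λ _ Ax → Ax) , (λ x Ax → cong (_∨ _) Ax) , trans (sym (+-identityʳ _)) ∣A∣+0≡∣J∣
  augmentTo (suc d) {A} {J} indA indJ ∣A∣+1+d≡∣J∣ with ind-aug indA indJ ∣A∣<∣J∣
    where
    ∣A∣<∣J∣ : ∣ A ∣ₑ < ∣ J ∣ₑ
    ∣A∣<∣J∣ = ≤-trans (s≤s (m≤m+n _ d)) (≤-reflexive (trans (sym (+-suc _ d)) ∣A∣+1+d≡∣J∣))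
  ... | e , Je , Ae , indA+e
    with augmentTo d indA+e indJ (trans (cong (_+ d) (∣insert∣ e A Ae)) (trans (sym (+-suc _ d)) ∣A∣+1+d≡∣J∣))
  ... | K , indK , A+e⊆K , K⊆ , ∣K∣ = K , indK , (λ x Ax → A+e⊆K x (insert-⊇ e A x Ax)) , K⊆A∪J , ∣K∣
    where
    K⊆A∪J : K ⊆ₑ (A ∪ₑ J)
    K⊆A∪J x Kx with ∨-true (K⊆ x Kx)
    ... | inj₂ Jx = trans (cong (A x ∨_) Jx) (∨-zeroʳ _)
    ... | inj₁ A+e∋x with insert-cases e A x A+e∋x
    ...   | inj₁ refl = trans (cong (A e ∨_) Je) (∨-zeroʳ _)
    ...   | inj₂ Ax = cong (_∨ J x) Ax

  Spans : EdgeSet n → Edge n → Set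
  Spans B e = B e ≡ true ⊎ ¬ Ind (insertₑ e B)

  circuit-exchange : ∀ {B X e} → Ind B → IsCircuit n Ind X → ∣ X ∣ₑ ≡ suc ∣ B ∣ₑ → X e ≡ true →
                     B e ≡ false → Ind (insertₑ e B) →
                     Σ (Edge n) λ f → X f ≡ true × f ≢ e × ¬ Spans B f
  circuit-exchange {B} {X} {e} indB (X-dep , X-minimal) ∣X∣ Xe Be indB+e =
    exchange (augmentTo 1 (X-minimal e Xe) indB+e ∣X-e∣+1≡∣B+e∣)
    where
    ∣X-e∣+1≡∣B+e∣ : ∣ removeₑ e X ∣ₑ + 1 ≡ ∣ insertₑ e B ∣ₑ
    ∣X-e∣+1≡∣B+e∣ = trans (+-comm _ 1) (trans (sym (∣remove∣ e X Xe)) (trans ∣X∣ (sym (∣insert∣ e B Be))))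
    exchange : (Σ (EdgeSet n) λ K → Ind K × removeₑ e X ⊆ₑ K × K ⊆ₑ (removeₑ e X ∪ₑ insertₑ e B) ×
                                    ∣ K ∣ₑ ≡ ∣ insertₑ e B ∣ₑ) →
               Σ (Edge n) λ f → X f ≡ true × f ≢ e × ¬ Spans B f
    exchange (K , indK , X-e⊆K , K⊆ , ∣K∣) = escape (ind-aug indB indK ∣B∣<∣K∣)
      where
      ∣B∣<∣K∣ : ∣ B ∣ₑ < ∣ K ∣ₑ
      ∣B∣<∣K∣ = subst (∣ B ∣ₑ <_) (sym (trans ∣K∣ (∣insert∣ e B Be))) (n<1+n _)
      X⊆K : K e ≡ true → X ⊆ₑ K
      X⊆K Ke x Xx with e ==ₑ x in e≡x
      ... | true = subst (λ y → K y ≡ true) (==ₑ⇒≡ e x e≡x) Ke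
      ... | false = X-e⊆K x (remove-keep e X x (==ₑ-false⇒≢ e x e≡x) Xx)
      e∉K : K e ≢ true
      e∉K Ke = X-dep (ind-⊆ (X⊆K Ke) indK)
      escape : (Σ (Edge n) λ f → K f ≡ true × B f ≡ false × Ind (insertₑ f B)) →
               Σ (Edge n) λ f → X f ≡ true × f ≢ e × ¬ Spans B f
      escape (f , Kf , Bf , indB+f) with ∨-true (K⊆ f Kf)
      ... | inj₁ X-e∋f = let (e≢f , Xf) = remove-cases e X f X-e∋f in f , Xf , (λ f≡e → e≢f (sym f≡e)) , unspanned
        where
        unspanned : ¬ Spans B f
        unspanned (inj₁ Bf′) = true≢false (trans (sym Bf′) Bf)
        unspanned (inj₂ dep) = dep indB+f
      ... | inj₂ B+e∋f with insert-cases e B f B+e∋f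
      ...   | inj₁ refl = ⊥-elim (e∉K Kf)
      ...   | inj₂ Bf′ = ⊥-elim (true≢false (trans (sym Bf′) Bf))

  spanning-bound : ∀ {B} → Ind B → (∀ e → Spans B e) → ∀ F → Ind F → ∣ F ∣ₑ ≤ ∣ B ∣ₑ
  spanning-bound {B} indB spans F indF with ∣ F ∣ₑ ≤? ∣ B ∣ₑ
  ... | yes ∣F∣≤∣B∣ = ∣F∣≤∣B∣
  ... | no ∣F∣≰∣B∣ with ind-aug indB indF (≰⇒> ∣F∣≰∣B∣)
  ...   | f , _ , Bf , indB+f with spans f
  ...     | inj₁ Bf′ = ⊥-elim (true≢false (trans (sym Bf′) Bf))
  ...     | inj₂ dep = ⊥-elim (dep indB+f)

uniform-isMatroid : ∀ n r → IsMatroid n (UniformInd n r)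
uniform-isMatroid n r = record
  { ind-∅ = subst (_≤ r) (sym (count-∅ (allEdges n))) z≤n
  ; ind-⊆ = λ J⊆I ∣I∣≤r → ≤-trans (count-mono J⊆I (allEdges n)) ∣I∣≤r
  ; ind-aug = augment
  }
  where
  augment : ∀ {I J} → UniformInd n r I → UniformInd n r J → ∣ I ∣ₑ < ∣ J ∣ₑ →
            Σ (Edge n) λ e → J e ≡ true × I e ≡ false × UniformInd n r (insertₑ e I)
  augment {I} {J} _ ∣J∣≤r ∣I∣<∣J∣ =
    let (e , Je , Ie) = count-<⇒∈∖ (allEdges n) ∣I∣<∣J∣
    in e , Je , Ie , subst (_≤ r) (sym (∣insert∣ e I Ie)) (≤-trans ∣I∣<∣J∣ ∣J∣≤r)

1+[k∸1]≡k : ∀ {k} → 1 ≤ k → suc (k ∸ 1) ≡ k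
1+[k∸1]≡k k≥1 = m+[n∸m]≡n k≥1

uniform-isPkMatroid : ∀ n k → 1 ≤ k → IsPkMatroid n k (UniformInd n (k ∸ 1))
uniform-isPkMatroid n k k≥1 = uniform-isMatroid n (k ∸ 1) , isCircuit
  where
  isCircuit : ∀ X → IsPathEdgeSet n k X → IsCircuit n (UniformInd n (k ∸ 1)) X
  isCircuit X X-path =
    (λ ∣X∣≤k-1 → <⇒≱ (subst (k ∸ 1 <_) (sym (∣path∣ X X-path)) (≤-reflexive (1+[k∸1]≡k k≥1))) ∣X∣≤k-1) ,
    (λ e Xe → ≤-reflexive (suc-injective (trans (sym (∣remove∣ e X Xe)) (trans (∣path∣ X X-path) (sym (1+[k∸1]≡k k≥1))))))

module StandardPath {n k : ℕ} (k≥1 : 1 ≤ k) (k<n : k < n) where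

  vertex : Fin (suc k) → Fin n
  vertex i = fromℕ< (≤-<-trans (s≤s⁻¹ (toℕ<n i)) k<n)

  vertex-injective : Injective _≡_ _≡_ vertex
  vertex-injective {i} {j} eq = toℕ-injective (trans (sym (toℕ-fromℕ< _)) (trans (cong toℕ eq) (toℕ-fromℕ< _)))

  P₀ : EdgeSet n
  P₀ = pathEdges vertex

  P₀-isPath : IsPathEdgeSet n k P₀
  P₀-isPath = pathEdges-isPath vertex vertex-injective

  P₀-∋ : ∀ e i → i < k → Joinsℕ e i (suc i) → P₀ e ≡ true
  P₀-∋ e i i<k J = pathEdges-∋ vertex e (fromℕ< i<k) (subst₂ (Joinsℕ e) (sym i≡) (sym 1+i≡) J)
    where
    i≡ : toℕ (vertex (inject₁ (fromℕ< i<k))) ≡ i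
    i≡ = trans (toℕ-fromℕ< _) (trans (toℕ-inject₁ _) (toℕ-fromℕ< i<k))
    1+i≡ : toℕ (vertex (fsuc (fromℕ< i<k))) ≡ suc i
    1+i≡ = trans (toℕ-fromℕ< _) (cong suc (toℕ-fromℕ< i<k))

  lastEdge : Edge n
  lastEdge = (fromℕ< (≤-<-trans (m∸n≤m k 1) k<n) , fromℕ< k<n) ,
             subst₂ _<_ (sym (toℕ-fromℕ< _)) (sym (toℕ-fromℕ< _)) (≤-reflexive (1+[k∸1]≡k k≥1))

  lastEdge-joins : Joinsℕ lastEdge (k ∸ 1) (suc (k ∸ 1))
  lastEdge-joins = inj₁ (toℕ-fromℕ< _ , trans (toℕ-fromℕ< _) (sym (1+[k∸1]≡k k≥1)))

  P₀-∋-lastEdge : P₀ lastEdge ≡ true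
  P₀-∋-lastEdge = P₀-∋ lastEdge (k ∸ 1) (≤-reflexive (1+[k∸1]≡k k≥1)) lastEdge-joins

  B₀ : EdgeSet n
  B₀ = removeₑ lastEdge P₀

  ∣B₀∣ : ∣ B₀ ∣ₑ ≡ k ∸ 1
  ∣B₀∣ = suc-injective (trans (sym (∣remove∣ lastEdge P₀ P₀-∋-lastEdge)) (trans (∣path∣ P₀ P₀-isPath) (sym (1+[k∸1]≡k k≥1))))

  B₀-∋ : ∀ e i → suc (suc i) ≤ k → Joinsℕ e i (suc i) → B₀ e ≡ true
  B₀-∋ e i 2+i≤k J = remove-keep lastEdge P₀ e lastEdge≢e (P₀-∋ e i (<-trans (n<1+n i) 2+i≤k) J)
    where
    high≢k : Joinsℕ e i (suc i) → toℕ (high e) ≢ k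
    high≢k (inj₁ (_ , h≡1+i)) h≡k = <-irrefl (trans (sym h≡1+i) h≡k) 2+i≤k
    high≢k (inj₂ (_ , h≡i)) h≡k = <-irrefl (trans (sym h≡i) h≡k) (<-trans (n<1+n i) 2+i≤k)
    lastEdge≢e : lastEdge ≢ e
    lastEdge≢e eq = high≢k J (trans (sym (cong (λ x → toℕ (high x)) eq)) (toℕ-fromℕ< k<n))

span-pathClosed : ∀ {n k} {Ind : EdgeSet n → Set} (PM : IsPkMatroid n k Ind) {B : EdgeSet n} →
                  Ind B → suc ∣ B ∣ₑ ≡ k → PathClosed n k (MatroidFacts.Spans (proj₁ PM) B)
span-pathClosed (M , circuits) {B} indB ∣B∣ X X-path e Xe others with B e in Be
... | true = inj₁ refl
... | false = inj₂ λ indB+e →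
  let (f , Xf , f≢e , ¬spans) = circuit-exchange indB (circuits X X-path) (trans (∣path∣ X X-path) (sym ∣B∣))
                                                 Xe Be indB+e
  in ¬spans (others f Xf f≢e)
  where open MatroidFacts M

pkMatroid-≼-uniform : ∀ {n k} → 1 ≤ k → k < n → ∀ Ind → IsPkMatroid n k Ind → Ind ≼ UniformInd n (k ∸ 1)
pkMatroid-≼-uniform {n} {k} k≥1 k<n Ind PM@(M , circuits) F indF =
  subst (∣ F ∣ₑ ≤_) ∣B₀∣ (spanning-bound indB₀ spansAll F indF)
  where
  open StandardPath k≥1 k<n
  open MatroidFacts M
  indB₀ : Ind B₀
  indB₀ = proj₂ (circuits P₀ P₀-isPath) lastEdge P₀-∋-lastEdge
  spansAll : ∀ e → Spans B₀ e
  spansAll = PathClosure.total k≥1 k<n (Spans B₀) (λ i 2+i≤k e J → inj₁ (B₀-∋ e i 2+i≤k J))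
               (span-pathClosed PM indB₀ (trans (cong suc ∣B₀∣) (1+[k∸1]≡k k≥1)))

-- Proper sequences and val_{P_k}

<ᵇ-true : ∀ {a b} → a < b → (a <ᵇ b) ≡ true
<ᵇ-true a<b = Equivalence.to T-≡ (<⇒<ᵇ a<b)

<ᵇ-false : ∀ {a b} → b ≤ a → (a <ᵇ b) ≡ false
<ᵇ-false {a} {b} b≤a with a <ᵇ b in eq
... | true = ⊥-elim (<⇒≱ (<ᵇ⇒< a b (Equivalence.from T-≡ eq)) b≤a)
... | false = refl

data SnocView {m : ℕ} : Fin (suc m) → Set where
  old : (j : Fin m) → SnocView (inject₁ j)
  new : SnocView (fromℕ m)

snocView : ∀ {m} (i : Fin (suc m)) → SnocView i
snocView {zero} fzero = new
snocView {suc m} fzero = old fzero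
snocView {suc m} (fsuc i) with snocView i
... | old j = old (fsuc j)
... | new = new

snoc : ∀ {A : Set} {m} → (Fin m → A) → A → Fin (suc m) → A
snoc {m = zero} S X _ = X
snoc {m = suc m} S X fzero = S fzero
snoc {m = suc m} S X (fsuc i) = snoc (λ j → S (fsuc j)) X i

snoc-old : ∀ {A : Set} {m} (S : Fin m → A) X (j : Fin m) → snoc S X (inject₁ j) ≡ S j
snoc-old S X fzero = refl
snoc-old S X (fsuc j) = snoc-old (λ j → S (fsuc j)) X j

snoc-new : ∀ {A : Set} {m} (S : Fin m → A) X → snoc S X (fromℕ m) ≡ X
snoc-new {m = zero} S X = refl
snoc-new {m = suc m} S X = snoc-new (λ j → S (fsuc j)) X

module _ {n : ℕ} where

  unionAll-anyFin : ∀ {m} (S : Fin m → EdgeSet n) x → unionAll S x ≡ anyFin m (λ j → S j x)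
  unionAll-anyFin S x = any-tabulate (λ j → S j x) (λ i → i)

  unionBefore-anyFin : ∀ {m} (S : Fin m → EdgeSet n) i x →
                       unionBefore S i x ≡ anyFin m (λ j → (toℕ j <ᵇ toℕ i) ∧ S j x)
  unionBefore-anyFin S i x = any-tabulate (λ j → (toℕ j <ᵇ toℕ i) ∧ S j x) (λ i → i)

  unionAll-snoc : ∀ {m} (T : Fin (suc m) → EdgeSet n) x → unionAll T x ≡ unionAll (init T) x ∨ last T x
  unionAll-snoc {m} T x = begin
    unionAll T x                                       ≡⟨ unionAll-anyFin T x ⟩
    anyFin (suc m) (λ j → T j x)                       ≡⟨ anyFin-snoc m (λ j → T j x) ⟩
    anyFin m (λ j → init T j x) ∨ last T x             ≡⟨ cong (_∨ last T x) (sym (unionAll-anyFin (init T) x)) ⟩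
    unionAll (init T) x ∨ last T x ∎
    where open ≡-Reasoning

  unionBefore-last : ∀ {m} (T : Fin (suc m) → EdgeSet n) x → unionBefore T (fromℕ m) x ≡ unionAll (init T) x
  unionBefore-last {m} T x = begin
    unionBefore T (fromℕ m) x
      ≡⟨ unionBefore-anyFin T (fromℕ m) x ⟩
    anyFin (suc m) (λ j → (toℕ j <ᵇ toℕ (fromℕ m)) ∧ T j x)
      ≡⟨ anyFin-snoc m (λ j → (toℕ j <ᵇ toℕ (fromℕ m)) ∧ T j x) ⟩
    anyFin m (λ j → (toℕ (inject₁ j) <ᵇ toℕ (fromℕ m)) ∧ init T j x) ∨ ((toℕ (fromℕ m) <ᵇ toℕ (fromℕ m)) ∧ last T x)
      ≡⟨ cong₂ _∨_ (anyFin-cong m (λ j → cong (_∧ init T j x) earlier)) (cong (_∧ last T x) (<ᵇ-false {toℕ (fromℕ m)} ≤-refl)) ⟩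
    anyFin m (λ j → init T j x) ∨ false
      ≡⟨ ∨-identityʳ _ ⟩
    anyFin m (λ j → init T j x)
      ≡⟨ sym (unionAll-anyFin (init T) x) ⟩
    unionAll (init T) x ∎
    where
    open ≡-Reasoning
    earlier : ∀ {j} → (toℕ (inject₁ j) <ᵇ toℕ (fromℕ m)) ≡ true
    earlier {j} = <ᵇ-true (subst₂ _<_ (sym (toℕ-inject₁ j)) (sym (toℕ-fromℕ m)) (toℕ<n j))

  unionBefore-inject₁ : ∀ {m} (T : Fin (suc m) → EdgeSet n) (i : Fin m) x →
                        unionBefore T (inject₁ i) x ≡ unionBefore (init T) i x
  unionBefore-inject₁ {m} T i x = begin
    unionBefore T (inject₁ i) x
      ≡⟨ unionBefore-anyFin T (inject₁ i) x ⟩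
    anyFin (suc m) (λ j → (toℕ j <ᵇ toℕ (inject₁ i)) ∧ T j x)
      ≡⟨ anyFin-snoc m (λ j → (toℕ j <ᵇ toℕ (inject₁ i)) ∧ T j x) ⟩
    anyFin m (λ j → (toℕ (inject₁ j) <ᵇ toℕ (inject₁ i)) ∧ init T j x) ∨ ((toℕ (fromℕ m) <ᵇ toℕ (inject₁ i)) ∧ last T x)
      ≡⟨ cong₂ _∨_ (anyFin-cong m (λ j → cong (λ b → (b <ᵇ toℕ (inject₁ i)) ∧ init T j x) (toℕ-inject₁ j)))
                   (cong (_∧ last T x) (<ᵇ-false lastLater)) ⟩
    anyFin m (λ j → (toℕ j <ᵇ toℕ (inject₁ i)) ∧ init T j x) ∨ false
      ≡⟨ ∨-identityʳ _ ⟩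
    anyFin m (λ j → (toℕ j <ᵇ toℕ (inject₁ i)) ∧ init T j x)
      ≡⟨ anyFin-cong m (λ j → cong (λ b → (toℕ j <ᵇ b) ∧ init T j x) (toℕ-inject₁ i)) ⟩
    anyFin m (λ j → (toℕ j <ᵇ toℕ i) ∧ init T j x)
      ≡⟨ sym (unionBefore-anyFin (init T) i x) ⟩
    unionBefore (init T) i x ∎
    where
    open ≡-Reasoning
    lastLater : toℕ (inject₁ i) ≤ toℕ (fromℕ m)
    lastLater = subst₂ _≤_ (sym (toℕ-inject₁ i)) (sym (toℕ-fromℕ m)) (<⇒≤ (toℕ<n i))

init-proper : ∀ {n k m} (T : Fin (suc (suc m)) → EdgeSet n) → IsProperSeq n k (suc (suc m)) T →
              IsProperSeq n k (suc m) (init T)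
init-proper T (paths , fresh) =
  (λ i → paths (inject₁ i)) ,
  λ i 1≤i T⊆ → fresh (inject₁ i) (subst (1 ≤_) (sym (toℕ-inject₁ i)) 1≤i)
                     (λ x Tx → trans (unionBefore-inject₁ T i x) (T⊆ x Tx))

module _ {n : ℕ} where

  ⊆ₑ-or-∈∖ : (X U : EdgeSet n) → X ⊆ₑ U ⊎ (Σ (Edge n) λ x → X x ≡ true × U x ≡ false)
  ⊆ₑ-or-∈∖ X U with findEdge (λ x → X x ∧ not (U x))
  ... | inj₁ (x , h) = inj₂ (x , ∧-conicalˡ _ _ h , not-true (∧-conicalʳ (X x) _ h))
  ... | inj₂ none = inj₁ X⊆U
    where
    X⊆U : X ⊆ₑ U
    X⊆U x Xx with U x in Ux
    ... | true = refl
    ... | false = ⊥-elim (true≢false (trans (sym (cong₂ _∧_ Xx (cong not Ux))) (none x)))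

  ⊂⇒∣∣< : ∀ {A C : EdgeSet n} x → A ⊆ₑ C → C x ≡ true → A x ≡ false → suc ∣ A ∣ₑ ≤ ∣ C ∣ₑ
  ⊂⇒∣∣< {A} {C} x A⊆C Cx Ax = subst (_≤ ∣ C ∣ₑ) (∣insert∣ x A Ax) (count-mono A+x⊆C (allEdges n))
    where
    A+x⊆C : insertₑ x A ⊆ₑ C
    A+x⊆C y A+x∋y with insert-cases x A y A+x∋y
    ... | inj₁ refl = Cx
    ... | inj₂ Ay = A⊆C y Ay

  unionAll-cong : ∀ {m} {S T : Fin m → EdgeSet n} → (∀ i x → S i x ≡ T i x) → ∀ x → unionAll S x ≡ unionAll T x
  unionAll-cong {m} {S} {T} S≗T x =
    trans (unionAll-anyFin S x) (trans (anyFin-cong m (λ i → S≗T i x)) (sym (unionAll-anyFin T x)))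

  unionBefore-cong : ∀ {m} {S T : Fin m → EdgeSet n} → (∀ i x → S i x ≡ T i x) →
                     ∀ i x → unionBefore S i x ≡ unionBefore T i x
  unionBefore-cong {m} {S} {T} S≗T i x =
    trans (unionBefore-anyFin S i x)
          (trans (anyFin-cong m (λ j → cong ((toℕ j <ᵇ toℕ i) ∧_) (S≗T j x))) (sym (unionBefore-anyFin T i x)))

  init-snoc : ∀ {m} (S : Fin m → EdgeSet n) X i x → init (snoc S X) i x ≡ S i x
  init-snoc S X i x = cong (λ Y → Y x) (snoc-old S X i)

  unionAll-snoc′ : ∀ {m} (S : Fin m → EdgeSet n) X x → unionAll (snoc S X) x ≡ unionAll S x ∨ X x
  unionAll-snoc′ S X x =
    trans (unionAll-snoc (snoc S X) x) (cong₂ _∨_ (unionAll-cong (init-snoc S X) x) (cong (λ Y → Y x) (snoc-new S X)))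

snoc-proper : ∀ {n k m} {S : Fin (suc m) → EdgeSet n} {X} → IsProperSeq n k (suc m) S → IsPathEdgeSet n k X →
              ¬ (X ⊆ₑ unionAll S) → IsProperSeq n k (suc (suc m)) (snoc S X)
snoc-proper {n} {k} {m} {S} {X} (paths , fresh) X-path X⊈ = paths′ , fresh′
  where
  paths′ : ∀ i → IsPathEdgeSet n k (snoc S X i)
  paths′ i with snocView i
  ... | old j = subst (IsPathEdgeSet n k) (sym (snoc-old S X j)) (paths j)
  ... | new = subst (IsPathEdgeSet n k) (sym (snoc-new S X)) X-path
  fresh′ : ∀ i → 1 ≤ toℕ i → ¬ (snoc S X i ⊆ₑ unionBefore (snoc S X) i)
  fresh′ i 1≤i ⊆before with snocView i
  ... | old j = fresh j (subst (1 ≤_) (toℕ-inject₁ j) 1≤i) λ x Sx →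
    trans (sym (trans (unionBefore-inject₁ (snoc S X) j x) (unionBefore-cong (init-snoc S X) j x)))
          (⊆before x (trans (init-snoc S X j x) Sx))
  ... | new = X⊈ λ x Xx →
    trans (sym (trans (unionBefore-last (snoc S X) x) (unionAll-cong (init-snoc S X) x)))
          (⊆before x (trans (cong (λ Y → Y x) (snoc-new S X)) Xx))

-- Each path of a proper sequence after the first contributes at least one new edge.
∣⋃proper∣ : ∀ {n k} → 1 ≤ k → ∀ m (S : Fin (suc m) → EdgeSet n) → IsProperSeq n k (suc m) S →
            suc m + (k ∸ 1) ≤ ∣ unionAll S ∣ₑ
∣⋃proper∣ {n} {k} k≥1 zero S (paths , _) = ≤-reflexive (begin
  1 + (k ∸ 1)              ≡⟨ 1+[k∸1]≡k k≥1 ⟩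
  k                        ≡⟨ ∣path∣ (S fzero) (paths fzero) ⟨
  ∣ S fzero ∣ₑ             ≡⟨ count-cong (λ x → sym (trans (unionAll-anyFin S x) (∨-identityʳ _))) (allEdges n) ⟩
  ∣ unionAll S ∣ₑ ∎)
  where open ≡-Reasoning
∣⋃proper∣ {n} {k} k≥1 (suc m) S P@(_ , fresh) with ⊆ₑ-or-∈∖ (last S) (unionAll (init S))
... | inj₁ last⊆ = ⊥-elim (fresh (fromℕ (suc m)) (s≤s z≤n) (λ x Xx → trans (unionBefore-last S x) (last⊆ x Xx)))
... | inj₂ (x , Xx , Ux) =
  ≤-trans (s≤s (∣⋃proper∣ k≥1 m (init S) (init-proper S P))) (⊂⇒∣∣< x init⊆ (last⊆ x Xx) Ux)
  where
  init⊆ : unionAll (init S) ⊆ₑ unionAll S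
  init⊆ y Uy = trans (unionAll-snoc S y) (cong (_∨ last S y) Uy)
  last⊆ : last S ⊆ₑ unionAll S
  last⊆ y Xy = trans (unionAll-snoc S y) (trans (cong (unionAll (init S) y ∨_) Xy) (∨-zeroʳ _))

module Covering {n k : ℕ} (k≥1 : 1 ≤ k) (k<n : k < n) where
  open StandardPath k≥1 k<n

  OneNewEdge : EdgeSet n → Set
  OneNewEdge U = Σ (EdgeSet n) λ X → IsPathEdgeSet n k X × Σ (Edge n) λ e → X e ≡ true × U e ≡ false ×
                 (∀ e′ → X e′ ≡ true → e′ ≢ e → U e′ ≡ true)

  coveredOrOneNewEdge : (U : EdgeSet n) → P₀ ⊆ₑ U → ∀ e → U e ≡ true ⊎ OneNewEdge U
  coveredOrOneNewEdge U P₀⊆U = PathClosure.total k≥1 k<n (λ e → U e ≡ true ⊎ OneNewEdge U) initial closed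
    where
    initial : ∀ i → suc (suc i) ≤ k → ∀ e → Joinsℕ e i (suc i) → U e ≡ true ⊎ OneNewEdge U
    initial i 2+i≤k e J = inj₁ (P₀⊆U e (P₀-∋ e i (<-trans (n<1+n i) 2+i≤k) J))
    closed : PathClosed n k (λ e → U e ≡ true ⊎ OneNewEdge U)
    closed X X-path e Xe others with U e in Ue
    ... | true = inj₁ refl
    ... | false with ⊆ₑ-or-∈∖ (removeₑ e X) U
    ...   | inj₁ X-e⊆U = inj₂ (X , X-path , e , Xe , Ue , λ e′ Xe′ e′≢e → X-e⊆U e′ (remove-keep e X e′ (λ eq → e′≢e (sym eq)) Xe′))
    ...   | inj₂ (e′ , X-e∋e′ , Ue′) with remove-cases e X e′ X-e∋e′
    ...     | e≢e′ , Xe′ with others e′ Xe′ (λ eq → e≢e′ (sym eq))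
    ...       | inj₁ Ue′′ = ⊥-elim (true≢false (trans (sym Ue′′) Ue′))
    ...       | inj₂ oneNew = inj₂ oneNew

  -- Every path after the first adds exactly one new edge.
  record TightSequence : Set where
    field
      len : ℕ
      seq : Fin (suc len) → EdgeSet n
      proper : IsProperSeq n k (suc len) seq
      covers-P₀ : P₀ ⊆ₑ unionAll seq
      tight : ∣ unionAll seq ∣ₑ ≡ suc len + (k ∸ 1)

  open TightSequence

  start : TightSequence
  start = record
    { len = 0
    ; seq = λ _ → P₀
    ; proper = (λ _ → P₀-isPath) , λ { fzero () }
    ; covers-P₀ = λ x P₀x → trans (⋃P₀ x) P₀x
    ; tight = trans (count-cong ⋃P₀ (allEdges n)) (trans (∣path∣ P₀ P₀-isPath) (sym (1+[k∸1]≡k k≥1)))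
    }
    where
    ⋃P₀ : ∀ x → unionAll {m = 1} (λ _ → P₀) x ≡ P₀ x
    ⋃P₀ x = trans (unionAll-anyFin {m = 1} (λ _ → P₀) x) (∨-identityʳ _)

  grow : (T : TightSequence) → ∀ x → unionAll (seq T) x ≡ false →
         Σ TightSequence λ T′ → ∣ unionAll (seq T′) ∣ₑ ≡ suc ∣ unionAll (seq T) ∣ₑ
  grow T x Ux with coveredOrOneNewEdge (unionAll (seq T)) (covers-P₀ T) x
  ... | inj₁ Ux′ = ⊥-elim (true≢false (trans (sym Ux′) Ux))
  ... | inj₂ (X , X-path , e , Xe , Ue , others) = T′ , ∣U′∣
    where
    U : EdgeSet n
    U = unionAll (seq T)
    U′≗U+e : ∀ y → unionAll (snoc (seq T) X) y ≡ insertₑ e U y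
    U′≗U+e y with e ==ₑ y in e≡y
    ... | true = trans (unionAll-snoc′ (seq T) X y)
                       (trans (cong (U y ∨_) (trans (cong X (sym (==ₑ⇒≡ e y e≡y))) Xe)) (∨-zeroʳ _))
    ... | false with U y in Uy
    ...   | true = trans (unionAll-snoc′ (seq T) X y) (cong (_∨ X y) Uy)
    ...   | false with X y in Xy
    ...     | true = ⊥-elim (true≢false (trans (sym (others y Xy (λ q → ==ₑ-false⇒≢ e y e≡y (sym q)))) Uy))
    ...     | false = trans (unionAll-snoc′ (seq T) X y) (cong₂ _∨_ Uy Xy)
    ∣U′∣ : ∣ unionAll (snoc (seq T) X) ∣ₑ ≡ suc ∣ U ∣ₑ
    ∣U′∣ = trans (count-cong U′≗U+e (allEdges n)) (∣insert∣ e U Ue)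
    T′ : TightSequence
    T′ = record
      { len = suc (len T)
      ; seq = snoc (seq T) X
      ; proper = snoc-proper (proper T) X-path (λ X⊆U → true≢false (trans (sym (X⊆U e Xe)) Ue))
      ; covers-P₀ = λ y P₀y → trans (unionAll-snoc′ (seq T) X y) (cong (_∨ X y) (covers-P₀ T y P₀y))
      ; tight = trans ∣U′∣ (cong suc (tight T))
      }

  fullₑ : EdgeSet n
  fullₑ _ = true

  growUntilCovering : ∀ d (T : TightSequence) → ∣ fullₑ ∣ₑ ≤ ∣ unionAll (seq T) ∣ₑ + d →
                      Σ TightSequence λ T′ → ∀ x → unionAll (seq T′) x ≡ true
  growUntilCovering d T full≤ with findEdge (λ x → not (unionAll (seq T) x))
  ... | inj₂ none = T , λ x → not-false (none x)
  growUntilCovering zero T full≤ | inj₁ (x , missing) =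
    ⊥-elim (<⇒≱ (subst (_≤ ∣ fullₑ ∣ₑ) (∣insert∣ x _ (not-true missing)) (count-mono (λ _ _ → refl) (allEdges n)))
                (subst (∣ fullₑ ∣ₑ ≤_) (+-identityʳ _) full≤))
  growUntilCovering (suc d) T full≤ | inj₁ (x , missing) =
    let (T′ , ∣U′∣) = grow T x (not-true missing)
    in growUntilCovering d T′ (subst (∣ fullₑ ∣ₑ ≤_) (trans (+-suc _ d) (cong (_+ d) (sym ∣U′∣))) full≤)

  covering : Σ TightSequence λ T → ∀ x → unionAll (seq T) x ≡ true
  covering = growUntilCovering ∣ fullₑ ∣ₑ start (m≤n+m ∣ fullₑ ∣ₑ ∣ unionAll (seq start) ∣ₑ)

subset-ofSize : ∀ {n} c (F : EdgeSet n) r → ∣ F ∣ₑ ≡ c → r ≤ c → Σ (EdgeSet n) λ I → I ⊆ₑ F × ∣ I ∣ₑ ≡ r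
subset-ofSize zero F r ∣F∣≡0 r≤0 = F , (λ _ Fx → Fx) , trans ∣F∣≡0 (sym (n≤0⇒n≡0 r≤0))
subset-ofSize {n} (suc c) F r ∣F∣≡1+c r≤1+c with r ≟ suc c
... | yes r≡1+c = F , (λ _ Fx → Fx) , trans ∣F∣≡1+c (sym r≡1+c)
... | no r≢1+c =
  let (e , Fe , _) = count-<⇒∈∖ {F = ∅ₑ} (allEdges n) (subst₂ _<_ (sym (count-∅ (allEdges n))) (sym ∣F∣≡1+c) z<s)
      (I , I⊆F-e , ∣I∣) = subset-ofSize c (removeₑ e F) r (suc-injective (trans (sym (∣remove∣ e F Fe)) ∣F∣≡1+c))
                                         (s≤s⁻¹ (≤∧≢⇒< r≤1+c r≢1+c))
  in I , (λ x Ix → proj₂ (remove-cases e F x (I⊆F-e x Ix))) , ∣I∣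

uniform-rank : ∀ n r F → IsRank n (UniformInd n r) F (∣ F ∣ₑ ⊓ r)
uniform-rank n r F =
  (let (I , I⊆F , ∣I∣) = subset-ofSize ∣ F ∣ₑ F (∣ F ∣ₑ ⊓ r) refl (m⊓n≤m _ _)
   in I , I⊆F , subst (_≤ r) (sym ∣I∣) (m⊓n≤n _ _) , ∣I∣) ,
  λ I I⊆F ∣I∣≤r → ⊓-glb (count-mono I⊆F (allEdges n)) ∣I∣≤r

module _ {n : ℕ} (F U : EdgeSet n) where

  ⊆∪ₑˡ : F ⊆ₑ (F ∪ₑ U)
  ⊆∪ₑˡ x Fx = cong (_∨ U x) Fx

  ⊆∪ₑʳ : U ⊆ₑ (F ∪ₑ U)
  ⊆∪ₑʳ x Ux = trans (cong (F x ∨_) Ux) (∨-zeroʳ _)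

val-lowerBound : ∀ {n k} → 1 ≤ k → ∀ F m S → IsProperSeq n k m S → ∣ F ∣ₑ ⊓ (k ∸ 1) ≤ valSeq n m F S
val-lowerBound {n} k≥1 F zero S _ = ≤-trans (m⊓n≤m _ _) (count-mono (⊆∪ₑˡ F (unionAll S)) (allEdges n))
val-lowerBound {n} {k} k≥1 F (suc m) S P = begin
  ∣ F ∣ₑ ⊓ (k ∸ 1)                    ≤⟨ m⊓n≤n _ _ ⟩
  k ∸ 1                               ≡⟨ m+n∸m≡n (suc m) (k ∸ 1) ⟨
  suc m + (k ∸ 1) ∸ suc m             ≤⟨ ∸-monoˡ-≤ (suc m) (∣⋃proper∣ k≥1 m S P) ⟩
  ∣ unionAll S ∣ₑ ∸ suc m             ≤⟨ ∸-monoˡ-≤ (suc m) (count-mono (⊆∪ₑʳ F (unionAll S)) (allEdges n)) ⟩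
  ∣ F ∪ₑ unionAll S ∣ₑ ∸ suc m ∎
  where open ≤-Reasoning

val-attained : ∀ {n k} → 1 ≤ k → k < n → ∀ F →
               Σ ℕ λ m → Σ (Fin m → EdgeSet n) λ S → IsProperSeq n k m S × valSeq n m F S ≡ ∣ F ∣ₑ ⊓ (k ∸ 1)
val-attained {n} {k} k≥1 k<n F with ∣ F ∣ₑ ≤? k ∸ 1
... | yes ∣F∣≤k-1 = 0 , (λ ()) , ((λ ()) , (λ ())) ,
  trans (count-cong (λ x → ∨-identityʳ (F x)) (allEdges n)) (sym (m≤n⇒m⊓n≡m ∣F∣≤k-1))
... | no ∣F∣≰k-1 =
  let (T , covers) = covering
  in suc (len T) , seq T , proper T , (begin
    ∣ F ∪ₑ unionAll (seq T) ∣ₑ ∸ suc (len T)  ≡⟨ cong (_∸ suc (len T)) (count-cong (⋃-absorbs covers) (allEdges n)) ⟩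
    ∣ unionAll (seq T) ∣ₑ ∸ suc (len T)       ≡⟨ cong (_∸ suc (len T)) (tight T) ⟩
    suc (len T) + (k ∸ 1) ∸ suc (len T)       ≡⟨ m+n∸m≡n (suc (len T)) (k ∸ 1) ⟩
    k ∸ 1                                     ≡⟨ m≥n⇒m⊓n≡n (<⇒≤ (≰⇒> ∣F∣≰k-1)) ⟨
    ∣ F ∣ₑ ⊓ (k ∸ 1) ∎)
  where
  open Covering k≥1 k<n
  open TightSequence
  open ≡-Reasoning
  ⋃-absorbs : ∀ {U} → (∀ x → U x ≡ true) → ∀ x → (F ∪ₑ U) x ≡ U x
  ⋃-absorbs {U} full x = trans (cong (F x ∨_) (full x)) (trans (∨-zeroʳ _) (sym (full x)))

theorem3p5 : (k : ℕ) → 1 ≤ k → (n : ℕ) → suc k ≤ n →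
    IsPkMatroid n k (UniformInd n (k ∸ 1)) ×
    (∀ Ind → IsPkMatroid n k Ind → Ind ≼ UniformInd n (k ∸ 1)) ×
    (∀ Ind → IsPkMatroid n k Ind →
      (∀ Ind′ → IsPkMatroid n k Ind′ → Ind ≼ Ind′ → Ind′ ≼ Ind) →
      (Ind ≼ UniformInd n (k ∸ 1)) × (UniformInd n (k ∸ 1) ≼ Ind)) ×
    (∀ F → Σ ℕ (λ v → IsValPk n k F v × IsRank n (UniformInd n (k ∸ 1)) F v))
theorem3p5 k k≥1 n k<n =
  uniform-isPkMatroid n k k≥1 ,
  pkMatroid-≼-uniform k≥1 k<n ,
  (λ Ind PM maximal → pkMatroid-≼-uniform k≥1 k<n Ind PM ,
                      maximal _ (uniform-isPkMatroid n k k≥1) (pkMatroid-≼-uniform k≥1 k<n Ind PM)) ,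
  λ F → ∣ F ∣ₑ ⊓ (k ∸ 1) , (val-attained k≥1 k<n F , val-lowerBound k≥1 F) , uniform-rank n (k ∸ 1) F
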